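{- Let $G$ be a graph, $S\subseteq V(G)$, $(T,\delta)$ a rooted layout of $G$, $x$ a node of $T$, and $i=(X_{vc}^{\overline S},X_{vc}^{S},X_{\overline{vc}},Y_{vc}^{\overline S},Y_{vc}^{S})\in \mathbb{I}_x$. Let $X$ be a partial solution associated with $i$ and $(Y,\mathcal{P}_Y)$ a complement solution associated with $i$. If the graph $G[X\cup Y]_{\downarrow \operatorname{cc}(X\setminus S)\cup \mathcal{P}_Y}$ is a forest, then $G[X\cup Y]$ is an $S$-forest.
   Context: Notation: $\overline{U}=V(G)\setminus U$; $N(v)$ neighborhood; $N(U)=(\bigcup_{v\in U}N(v))\setminus U$; $\operatorname{cc}(Z)$ is the partition of $Z$ into vertex sets of components of $G[Z]$. $S$-cycle: cycle through a vertex of $S$; $S$-forest: graph with no $S$-cycle. A rooted layout $(T,\delta)$: rooted binary tree $T$ and bijection $\delta$ from $V(G)$ to leaves of $T$; $V_x$ = vertices mapped to leaves below node $x$. $\mathsf{mim}(A)$ = maximum induced matching size in the bipartite graph between $A$ and $\overline{A}$. Blocks/contractions: for a collection $\mathcal{A}$ of vertex sets, $G[\mathcal{A}]$ has vertex set $\mathcal{A}$, $A,B$ adjacent iff $N(A)\cap B\ne\emptyset$; $G[\mathcal{A},\mathcal{B}]$ is bipartite with edges only between $\mathcal{A}$ and $\mathcal{B}$ under the same rule; $G[\mathcal{A}\mid\mathcal{B}]$ has vertex set $\mathcal{A}\cup\mathcal{B}$ and edge set $E(G[\mathcal{A}])\cup E(G[\mathcal{A},\mathcal{B}])$. For $Z\subseteq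 V(G)$ and a partition $\mathcal{P}$ of $Z\setminus S$, $Z_{\downarrow\mathcal{P}}=\mathcal{P}\cup\{\{v\}:v\in Z\cap S\}$ and $G[Z]_{\downarrow\mathcal{P}}=G[Z_{\downarrow\mathcal{P}}]$. $d$-neighbor equivalence: for $A\subseteq V(G)$, $d\geq1$, $W,Z\subseteq A$ satisfy $W\equiv_A^d Z$ iff $\min(d,|W\cap N(u)|)=\min(d,|Z\cap N(u)|)$ for all $u\in\overline{A}$. Fix an ordering of $V(G)$; $\mathrm{rep}_A^d(W)$ is the lexicographically smallest minimum-size $R\subseteq A$ with $R\equiv_A^d W$, and $\mathcal{R}_A^d=\{\mathrm{rep}_A^d(W):W\subseteq A\}$. Indices: $\mathbb{I}_x$ is the set of tuples $i=(X_{vc}^{\overline S},X_{vc}^{S},X_{\overline{vc}},Y_{vc}^{\overline S},Y_{vc}^{S})\in 2^{\mathcal{R}_{V_x}^2}\times2^{\mathcal{R}_{V_x}^1}\times\mathcal{R}_{V_x}^1\times2^{\mathcal{R}_{\overline{V_x}}^2}\times2^{\mathcal{R}_{\overline{V_x}}^1}$ with $|X_{vc}^{\overline S}|+|X_{vc}^{S}|+|Y_{vc}^{\overline S}|+|Y_{vc}^{S}|\le 4\mathsf{mim}(V_x)$. For $X\subseteq V_x$, $\operatorname{aux}(X,i)=G[X_{\downarrow\operatorname{cc}(X\setminus S)}\mid Y_{vc}^{\overline S}\cup Y_{vc}^S]$. Partial solution: $X\subseteq V_x$ is associated with $i$ if (a) for every $R\in X_{vc}^S$ there is a unique $v\in X\cap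 S$ with $R\equiv_{V_x}^1\{v\}$; (b) for every $R\in X_{vc}^{\overline S}$ there is a unique $C\in\operatorname{cc}(X\setminus S)$ with $R\equiv_{V_x}^2 C$; (c) $\operatorname{aux}(X,i)$ is a forest; (d) for every $C\in\operatorname{cc}(X\setminus S)$ and every singleton $\{v\}\in Y_{vc}^S$, $|N(v)\cap C|\le1$; (e) for every $v\in X\cap S$ and $U\in Y_{vc}^{\overline S}\cup\operatorname{cc}(X\setminus S)$, $|N(v)\cap U|\le 1$; (f) $X_{\overline{vc}}\equiv_{V_x}^1 X\setminus \bigcup\mathsf{VC}_X$, where $\mathsf{VC}_X$ consists of the blocks $\{v\}$, $v\in X\cap S$, with $\mathrm{rep}_{V_x}^1(\{v\})\in X_{vc}^S$, and the $C\in\operatorname{cc}(X\setminus S)$ with $\mathrm{rep}_{V_x}^2(C)\in X_{vc}^{\overline S}$. Complement solution: a pair $(Y,\mathcal{P}_Y)$ with $Y\subseteq\overline{V_x}$ and $\mathcal{P}_Y$ a partition of $Y\setminus S$ is associated with $i$ if (a) for every $U\in Y_{vc}^S$ there is a unique $v\in Y\cap S$ with $U\equiv_{\overline{V_x}}^1\{v\}$; (b) for every $U\in Y_{vc}^{\overline S}$ there is a unique $P\in\mathcal{P}_Y$ with $U\equiv_{\overline{V_x}}^2 P$; (c) $G[Y]_{\downarrow\mathcal{P}_Y}$ is a forest; (d) for every $P\in\mathcal{P}_Y$ and every singleton $\{v\}\in X_{vc}^S$, $|N(v)\cap P|\le1$; (e) for every $y\in Y\cap S$ and $R\in X_{vc}^{\overline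 S}\cup\mathcal{P}_Y$, $|N(y)\cap R|\le1$; (f) $N(X_{\overline{vc}})\cap\bigcup Y_{\overline{vc}}=\emptyset$, where $Y_{\overline{vc}}$ consists of the blocks $\{v\}$, $v\in Y\cap S$, with $\mathrm{rep}_{\overline{V_x}}^1(\{v\})\notin Y_{vc}^S$ and the $P\in\mathcal{P}_Y$ with $\mathrm{rep}_{\overline{V_x}}^2(P)\notin Y_{vc}^{\overline S}$. -}

module Defs where

open import Data.Nat using (ℕ; _≤_; _<_; _⊓_; _+_; _*_)
open import Data.Fin using (Fin)
open import Data.Fin.Subset
  using (Subset; _∈_; _∉_; _⊆_; _∩_; _∪_; _─_; ∁; ⁅_⁆; ∣_∣; Nonempty)
open import Data.List using (List; []; _∷_; length; _∷ʳ_; _++_)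
open import Data.List.Membership.Propositional using () renaming (_∈_ to _∈ₗ_; _∉_ to _∉ₗ_)
open import Data.List.Relation.Unary.All using (All)
open import Data.List.Relation.Unary.Any using (Any)
open import Data.List.Relation.Unary.AllPairs using (AllPairs)
open import Data.List.Relation.Unary.Linked using (Linked)
open import Data.List.Relation.Unary.Unique.Propositional using (Unique)
open import Data.Product using (Σ; ∃; ∃-syntax; _×_; _,_)
open import Data.Sum using (_⊎_)
open import Relation.Binary.PropositionalEquality using (_≡_; _≢_)
open import Relation.Nullary using (¬_)
open import Function.Definitions using (Injective)

record Graph (n : ℕ) : Set where
  field
    nbr    : Fin n → Subset n
    sym    : ∀ u v → v ∈ nbr u → u ∈ nbr v
    irrefl : ∀ v → v ∉ nbr v
open Graph public

-- Cycles in an (abstract, undirected) graph given by a vertex predicate V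
-- and an adjacency relation R: a closed walk x, x₁, …, xₖ, x with at
-- least 3 pairwise distinct vertices.

Cycle : {A : Set} → (A → Set) → (A → A → Set) → Set
Cycle {A} V R =
  Σ A λ x → Σ (List A) λ xs →
    (2 ≤ length xs) × Unique (x ∷ xs) × All V (x ∷ xs) × Linked R ((x ∷ xs) ∷ʳ x)

CycleThrough : {A : Set} → (A → Set) → (A → Set) → (A → A → Set) → Set
CycleThrough {A} P V R =
  Σ A λ x → Σ (List A) λ xs →
    (2 ≤ length xs) × Unique (x ∷ xs) × All V (x ∷ xs) × Linked R ((x ∷ xs) ∷ʳ x)
    × Any P (x ∷ xs)

Coll : ℕ → Set₁
Coll n = Subset n → Set

_∪ᶜ_ : ∀ {n} → Coll n → Coll n → Coll n
(𝒜 ∪ᶜ ℬ) B = 𝒜 B ⊎ ℬ B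

fromList : ∀ {n} → List (Subset n) → Coll n
fromList L B = B ∈ₗ L

module _ {n : ℕ} (G : Graph n) where

  -- N(A) ∩ B ≠ ∅, where N(A) = (⋃_{a∈A} N(a)) ∖ A
  NMeets : Subset n → Subset n → Set
  NMeets A B = ∃[ a ] ∃[ b ] (a ∈ A × b ∈ B × b ∉ A × b ∈ nbr G a)

  BAdj : Subset n → Subset n → Set
  BAdj A B = NMeets A B ⊎ NMeets B A

  Contr : Coll n → Subset n → Subset n → Set
  Contr 𝒜 A B = 𝒜 A × 𝒜 B × BAdj A B

  -- G[𝒜 | ℬ] : edges of G[𝒜] plus edges of the bipartite graph G[𝒜,ℬ]
  ContrBar : Coll n → Coll n → Subset n → Subset n → Set
  ContrBar 𝒜 ℬ A B =
    ((𝒜 A × 𝒜 B) ⊎ (𝒜 A × ℬ B) ⊎ (ℬ A × 𝒜 B)) × BAdj A B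

  ForestC : Coll n → Set
  ForestC 𝒜 = ¬ Cycle 𝒜 (Contr 𝒜)

  ForestCB : Coll n → Coll n → Set
  ForestCB 𝒜 ℬ = ¬ Cycle (𝒜 ∪ᶜ ℬ) (ContrBar 𝒜 ℬ)

  SForest : Subset n → Subset n → Set
  SForest S Z = ¬ CycleThrough (_∈ S) (_∈ Z) (λ u v → v ∈ nbr G u)

  data Reach (Z : Subset n) : Fin n → Fin n → Set where
    here : ∀ {v} → v ∈ Z → Reach Z v v
    step : ∀ {u w v} → u ∈ Z → w ∈ nbr G u → Reach Z w v → Reach Z u v

  cc : Subset n → Coll n
  cc Z C = ∃[ v ] (v ∈ Z × (∀ u → (u ∈ C → Reach Z v u) × (Reach Z v u → u ∈ C)))

  Down : Subset n → Subset n → Coll n → Coll n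
  Down S Z 𝒫 B = 𝒫 B ⊎ (∃[ v ] (v ∈ Z × v ∈ S × B ≡ ⁅ v ⁆))

  IsPartition : List (Subset n) → Subset n → Set
  IsPartition 𝒫 Z =
    All Nonempty 𝒫
    × AllPairs (λ P Q → ∀ v → v ∈ P → v ∉ Q) 𝒫
    × (∀ v → (v ∈ Z → ∃[ P ] (P ∈ₗ 𝒫 × v ∈ P)) × (∀ P → P ∈ₗ 𝒫 → v ∈ P → v ∈ Z))

  Equiv : ℕ → Subset n → Subset n → Subset n → Set
  Equiv d A W Z = ∀ u → u ∉ A → d ⊓ ∣ W ∩ nbr G u ∣ ≡ d ⊓ ∣ Z ∩ nbr G u ∣

  IsInducedMatching : Subset n → List (Fin n × Fin n) → Set
  IsInducedMatching A M =
    All (λ { (a , b) → a ∈ A × b ∉ A × b ∈ nbr G a }) M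
    × AllPairs (λ { (a , b) (a′ , b′) →
                    a ≢ a′ × b ≢ b′ × b′ ∉ nbr G a × b ∉ nbr G a′ }) M

  IsMim : Subset n → ℕ → Set
  IsMim A m =
    (∃[ M ] (IsInducedMatching A M × length M ≡ m))
    × (∀ M → IsInducedMatching A M → length M ≤ m)

  module _ (rank : Fin n → ℕ) where
    LexLeq : Subset n → Subset n → Set
    LexLeq R R′ =
      R ≡ R′ ⊎
      (∃[ i ] (i ∈ R × i ∉ R′ ×
        (∀ j → rank j < rank i → (j ∈ R → j ∈ R′) × (j ∈ R′ → j ∈ R))))

    IsRep : ℕ → Subset n → Subset n → Subset n → Set
    IsRep d A W R =
      R ⊆ A × Equiv d A R W
      × (∀ R′ → R′ ⊆ A → Equiv d A R′ W → ∣ R ∣ ≤ ∣ R′ ∣)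
      × (∀ R′ → R′ ⊆ A → Equiv d A R′ W → ∣ R′ ∣ ≡ ∣ R ∣ → LexLeq R R′)

    InReps : ℕ → Subset n → Subset n → Set
    InReps d A R = ∃[ W ] (W ⊆ A × IsRep d A W R)

    RepIn : ℕ → Subset n → Subset n → List (Subset n) → Set
    RepIn d A W L = ∃[ R ] (IsRep d A W R × R ∈ₗ L)

data Layout (n : ℕ) : Set where
  leaf : Fin n → Layout n
  node : Layout n → Layout n → Layout n

leaves : ∀ {n} → Layout n → List (Fin n)
leaves (leaf v)   = v ∷ []
leaves (node l r) = leaves l ++ leaves r

-- δ is a bijection from V(G) onto the leaves
IsLayout : ∀ {n} → Layout n → Set
IsLayout {n} T = Unique (leaves T) × (∀ (v : Fin n) → v ∈ₗ leaves T)

data NodeOf {n : ℕ} : Layout n → Layout n → Set where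
  here  : ∀ {t} → NodeOf t t
  left  : ∀ {x l r} → NodeOf x l → NodeOf x (node l r)
  right : ∀ {x l r} → NodeOf x r → NodeOf x (node l r)

V : ∀ {n} → Layout n → Subset n
V (leaf v)   = ⁅ v ⁆
V (node l r) = V l ∪ V r

record Index (n : ℕ) : Set where
  constructor mkIndex
  field
    XvcS̄ : List (Subset n)
    XvcS : List (Subset n)
    Xv̄c  : Subset n
    YvcS̄ : List (Subset n)
    YvcS : List (Subset n)
open Index public

module _ {n : ℕ} (G : Graph n) (S : Subset n) (rank : Fin n → ℕ) (Vx : Subset n) where

  -- i ∈ 𝕀_x   (lists without duplicates represent sets)
  InI : Index n → Set
  InI i =
    Unique (XvcS̄ i) × All (InReps G rank 2 Vx) (XvcS̄ i)
    × Unique (XvcS i) × All (InReps G rank 1 Vx) (XvcS i)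
    × InReps G rank 1 Vx (Xv̄c i)
    × Unique (YvcS̄ i) × All (InReps G rank 2 (∁ Vx)) (YvcS̄ i)
    × Unique (YvcS i) × All (InReps G rank 1 (∁ Vx)) (YvcS i)
    × ∃[ m ] (IsMim G Vx m
        × length (XvcS̄ i) + length (XvcS i) + length (YvcS̄ i) + length (YvcS i) ≤ 4 * m)

  AuxForest : Subset n → Index n → Set
  AuxForest X i =
    ForestCB G (Down G S X (cc G (X ─ S))) (fromList (YvcS̄ i ++ YvcS i))

  InVC : Subset n → Index n → Fin n → Set
  InVC X i u =
    (u ∈ X × u ∈ S × RepIn G rank 1 Vx ⁅ u ⁆ (XvcS i))
    ⊎ (∃[ C ] (cc G (X ─ S) C × u ∈ C × RepIn G rank 2 Vx C (XvcS̄ i)))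

  PartialSolution : Subset n → Index n → Set
  PartialSolution X i =
    X ⊆ Vx
    × (∀ R → R ∈ₗ XvcS i →
         ∃[ v ] ((v ∈ X × v ∈ S × Equiv G 1 Vx R ⁅ v ⁆)
                 × (∀ w → w ∈ X → w ∈ S → Equiv G 1 Vx R ⁅ w ⁆ → w ≡ v)))
    × (∀ R → R ∈ₗ XvcS̄ i →
         ∃[ C ] ((cc G (X ─ S) C × Equiv G 2 Vx R C)
                 × (∀ C′ → cc G (X ─ S) C′ → Equiv G 2 Vx R C′ → C′ ≡ C)))
    × AuxForest X i
    × (∀ C v → cc G (X ─ S) C → ⁅ v ⁆ ∈ₗ YvcS i → ∣ nbr G v ∩ C ∣ ≤ 1)
    × (∀ v U → v ∈ X → v ∈ S → (U ∈ₗ YvcS̄ i ⊎ cc G (X ─ S) U) → ∣ nbr G v ∩ U ∣ ≤ 1)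
    × ∃[ W ] ((∀ u → (u ∈ W → u ∈ X × ¬ InVC X i u) × (u ∈ X → ¬ InVC X i u → u ∈ W))
              × Equiv G 1 Vx (Xv̄c i) W)

  InYv̄c : Subset n → List (Subset n) → Index n → Fin n → Set
  InYv̄c Y 𝒫 i u =
    (u ∈ Y × u ∈ S × ¬ RepIn G rank 1 (∁ Vx) ⁅ u ⁆ (YvcS i))
    ⊎ (∃[ P ] (P ∈ₗ 𝒫 × u ∈ P × ¬ RepIn G rank 2 (∁ Vx) P (YvcS̄ i)))

  ComplementSolution : Subset n → List (Subset n) → Index n → Set
  ComplementSolution Y 𝒫 i =
    Y ⊆ ∁ Vx × IsPartition G 𝒫 (Y ─ S)
    × (∀ U → U ∈ₗ YvcS i →
         ∃[ v ] ((v ∈ Y × v ∈ S × Equiv G 1 (∁ Vx) U ⁅ v ⁆)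
                 × (∀ w → w ∈ Y → w ∈ S → Equiv G 1 (∁ Vx) U ⁅ w ⁆ → w ≡ v)))
    × (∀ U → U ∈ₗ YvcS̄ i →
         ∃[ P ] ((P ∈ₗ 𝒫 × Equiv G 2 (∁ Vx) U P)
                 × (∀ P′ → P′ ∈ₗ 𝒫 → Equiv G 2 (∁ Vx) U P′ → P′ ≡ P)))
    × ForestC G (Down G S Y (fromList 𝒫))
    × (∀ P v → P ∈ₗ 𝒫 → ⁅ v ⁆ ∈ₗ XvcS i → ∣ nbr G v ∩ P ∣ ≤ 1)
    × (∀ y R → y ∈ Y → y ∈ S → (R ∈ₗ XvcS̄ i ⊎ R ∈ₗ 𝒫) → ∣ nbr G y ∩ R ∣ ≤ 1)
    × (∀ w u → w ∈ Xv̄c i → u ∈ nbr G w → u ∉ Xv̄c i → ¬ InYv̄c Y 𝒫 i u)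

module Submission where

-- Idea: send every vertex of Z = X ∪ Y to its block of Z↓𝒬, 𝒬 = cc(X ∖ S) ∪ 𝒫.  A cycle
-- of G[Z] through v ∈ S becomes a closed walk of the contracted graph through the
-- singleton block {v}; after erasing loops it is a cycle there, provided the two
-- neighbours of v on the cycle land in different blocks.  They do, because each vertex
-- of Z ∩ S has at most one neighbour in each block: this is where conditions (d), (e),
-- (f) of partial and complement solutions are used, via neighbour equivalence.

open import Defs renaming (sym to nbr-sym)
open import Data.Nat using (ℕ; zero; suc; _≤_; _⊓_; z≤n; s≤s)
open import Data.Nat.Properties using (≤-trans; m≤n⇒m⊓n≡m; m⊓n≤n; module ≤-Reasoning)
  renaming (_≤?_ to _≤ℕ?_)
open import Data.Fin using (Fin; zero; suc)
open import Data.Fin.Properties using () renaming (_≟_ to _≟ᶠ_)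
open import Data.Fin.Subset
  using (Subset; inside; outside; _∩_; _∪_; _─_; ∁; ⁅_⁆; ∣_∣; _⊆_; Nonempty)
  renaming (_∈_ to _∈ˢ_; _∉_ to _∉ˢ_)
open import Data.Fin.Subset.Properties
  using (drop-there; nonempty?; Empty-unique; ∣⊥∣≡0; ∣⁅x⁆∣≡1; x∈⁅x⁆; x∈⁅y⁆⇒x≡y; p⊆q⇒∣p∣≤∣q∣;
         x∈p⇒∣p-x∣<∣p∣; x∈p∧x≢y⇒x∈p-y; x∈p∩q⁺; x∈p∩q⁻; ∩-comm; ∣p∩q∣≤∣q∣; ⊆-antisym;
         p─q⊆p; x∈p∧x∉q⇒x∈p─q; x∈p∪q⁺; x∈p∪q⁻; x∈p⇒x∉∁p; x∈∁p⇒x∉p)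
  renaming (_∈?_ to _∈ˢ?_)
open import Data.List using (List; []; _∷_; _∷ʳ_; _++_; length; drop; initLast; _∷ʳ′_)
import Data.List.Properties as Listₚ
open import Data.List.Membership.Propositional using (_∈_; find)
open import Data.List.Membership.Propositional.Properties using (∈-∃++)
open import Data.List.Relation.Unary.All as All using (All; []; _∷_)
import Data.List.Relation.Unary.All.Properties as Allₚ
open import Data.List.Relation.Unary.Any using (here; there)
open import Data.List.Relation.Unary.AllPairs using (AllPairs; []; _∷_)
open import Data.List.Relation.Unary.Linked using (Linked; []; [-]; _∷_)
open import Data.List.Relation.Unary.Unique.Propositional using (Unique)
import Data.List.Relation.Unary.Unique.Propositional.Properties as Uniqueₚ
open import Relation.Binary.Construct.Closure.Reflexive as Refl using (ReflClosure; refl; [_])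
open import Relation.Binary.Construct.Closure.ReflexiveTransitive using (Star; ε; _◅_)
open import Relation.Binary.Definitions using (DecidableEquality)
import Data.Vec.Base as Vec
open import Data.Vec.Properties using (≡-dec)
import Data.Bool.Properties as Boolₚ
open import Data.Product as Product using (Σ; ∃-syntax; _×_; _,_; proj₁; proj₂)
open import Data.Empty using (⊥-elim) renaming (⊥ to False)
open import Data.Sum as Sum using (_⊎_; inj₁; inj₂)
open import Function using (_∘_)
open import Function.Definitions using (Injective)
open import Relation.Nullary using (¬_; Dec; yes; no; contradiction; ¬¬-map)
open import Relation.Nullary.Decidable using (decidable-stable; ¬¬-excluded-middle)
open import Relation.Binary.PropositionalEquality using (_≡_; _≢_; refl; sym; trans; subst; cong; ≢-sym)

¬¬-∀ : ∀ {n} {P : Fin n → Set} → (∀ u → ¬ ¬ P u) → ¬ ¬ (∀ u → P u)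
¬¬-∀ {zero}  h k = k λ ()
¬¬-∀ {suc n} h k = h zero λ p₀ → ¬¬-∀ (h ∘ suc) λ ps → k λ { zero → p₀ ; (suc u) → ps u }

comprehension : ∀ {n} {P : Fin n → Set} → (∀ u → Dec (P u)) →
                Σ (Subset n) λ C → ∀ u → (u ∈ˢ C → P u) × (P u → u ∈ˢ C)
comprehension {zero}  d = Vec.[] , λ ()
comprehension {suc n} d with d zero | comprehension (d ∘ suc)
... | yes p₀  | C , C-def = inside Vec.∷ C , λ
  { zero    → (λ _ → p₀) , (λ _ → Vec.here)
  ; (suc u) → (proj₁ (C-def u) ∘ drop-there) , (Vec.there ∘ proj₂ (C-def u)) }
... | no ¬p₀ | C , C-def = outside Vec.∷ C , λ
  { zero    → (λ ()) , (λ p₀ → contradiction p₀ ¬p₀)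
  ; (suc u) → (proj₁ (C-def u) ∘ drop-there) , (Vec.there ∘ proj₂ (C-def u)) }

¬¬-comprehension : ∀ {n} (P : Fin n → Set) →
                   ¬ ¬ Σ (Subset n) λ C → ∀ u → (u ∈ˢ C → P u) × (P u → u ∈ˢ C)
¬¬-comprehension P k = ¬¬-∀ (λ u → ¬¬-excluded-middle) (k ∘ comprehension)

by-cases : {Goal : Set} → Dec Goal → (P : Set) → (P → Goal) → (¬ P → Goal) → Goal
by-cases goal? P if-P if-¬P = decidable-stable goal? λ ¬goal → ¬¬-excluded-middle λ
  { (yes p) → ¬goal (if-P p) ; (no ¬p) → ¬goal (if-¬P ¬p) }

module _ {n : ℕ} where

  ⁅x⁆⊆p : ∀ {p : Subset n} {x} → x ∈ˢ p → ⁅ x ⁆ ⊆ p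
  ⁅x⁆⊆p {p} {x} x∈p y∈⁅x⁆ = subst (_∈ˢ p) (sym (x∈⁅y⁆⇒x≡y x y∈⁅x⁆)) x∈p

  ∈⇒1≤∣p∣ : ∀ {p : Subset n} {x} → x ∈ˢ p → 1 ≤ ∣ p ∣
  ∈⇒1≤∣p∣ {p} {x} x∈p = subst (_≤ ∣ p ∣) (∣⁅x⁆∣≡1 x) (p⊆q⇒∣p∣≤∣q∣ (⁅x⁆⊆p x∈p))

  ∈⇒2≤∣p∣ : ∀ {p : Subset n} {x y} → x ∈ˢ p → y ∈ˢ p → x ≢ y → 2 ≤ ∣ p ∣
  ∈⇒2≤∣p∣ x∈p y∈p x≢y = ≤-trans (s≤s (∈⇒1≤∣p∣ (x∈p∧x≢y⇒x∈p-y y∈p (≢-sym x≢y)))) (x∈p⇒∣p-x∣<∣p∣ x∈p)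

  empty⇒∣p∣≡0 : ∀ {p : Subset n} → ¬ Nonempty p → ∣ p ∣ ≡ 0
  empty⇒∣p∣≡0 {p} empty = subst (λ q → ∣ q ∣ ≡ 0) (sym (Empty-unique empty)) (∣⊥∣≡0 n)

  1≤∣p∣⇒nonempty : ∀ {p : Subset n} → 1 ≤ ∣ p ∣ → Nonempty p
  1≤∣p∣⇒nonempty {p} 1≤∣p∣ with nonempty? p
  ... | yes ne = ne
  ... | no empty with subst (1 ≤_) (empty⇒∣p∣≡0 empty) 1≤∣p∣
  ...   | ()

  ∣p∣≤1⇒unique : ∀ {p : Subset n} → ∣ p ∣ ≤ 1 → ∀ {x y} → x ∈ˢ p → y ∈ˢ p → x ≡ y
  ∣p∣≤1⇒unique {p} ∣p∣≤1 {x} {y} x∈p y∈p with x ≟ᶠ y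
  ... | yes x≡y = x≡y
  ... | no x≢y with ≤-trans (∈⇒2≤∣p∣ x∈p y∈p x≢y) ∣p∣≤1
  ...   | s≤s ()

  unique⇒∣p∣≤1 : ∀ {p : Subset n} → (∀ {x y} → x ∈ˢ p → y ∈ˢ p → x ≡ y) → ∣ p ∣ ≤ 1
  unique⇒∣p∣≤1 {p} unique with nonempty? p
  ... | no empty = subst (_≤ 1) (sym (empty⇒∣p∣≡0 empty)) z≤n
  ... | yes (x , x∈p) = subst (∣ p ∣ ≤_) (∣⁅x⁆∣≡1 x) (p⊆q⇒∣p∣≤∣q∣ p⊆⁅x⁆)
    where
    p⊆⁅x⁆ : p ⊆ ⁅ x ⁆
    p⊆⁅x⁆ y∈p = subst (_∈ˢ ⁅ x ⁆) (unique x∈p y∈p) (x∈⁅x⁆ x)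

  ∣p∣≤1⇒p≡⁅x⁆ : ∀ {p : Subset n} {x} → ∣ p ∣ ≤ 1 → x ∈ˢ p → p ≡ ⁅ x ⁆
  ∣p∣≤1⇒p≡⁅x⁆ {p} {x} ∣p∣≤1 x∈p =
    ⊆-antisym (λ y∈p → subst (_∈ˢ ⁅ x ⁆) (∣p∣≤1⇒unique ∣p∣≤1 x∈p y∈p) (x∈⁅x⁆ x)) (⁅x⁆⊆p x∈p)

x∈p─q⇒x∉q : ∀ {n} (p q : Subset n) {x} → x ∈ˢ p ─ q → x ∉ˢ q
x∈p─q⇒x∉q (inside Vec.∷ p) (outside Vec.∷ q) Vec.here ()
x∈p─q⇒x∉q (_ Vec.∷ p) (_ Vec.∷ q) (Vec.there x∈p─q) (Vec.there x∈q) = x∈p─q⇒x∉q p q x∈p─q x∈q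

module _ {A : Set} {R : A → A → Set} where

  after : ∀ {x z} → Star R x z → List A
  after ε                 = []
  after (_◅_ {j = y} _ w) = y ∷ after w

  vertices : ∀ {x z} → Star R x z → List A
  vertices {x} w = x ∷ after w

  linked-snoc : ∀ {x z c} (w : Star R x z) → R z c → Linked R (vertices w ∷ʳ c)
  linked-snoc ε       r = r ∷ [-]
  linked-snoc (e ◅ w) r = e ∷ linked-snoc w r

  walk-of-linked : ∀ x mid z → Linked R (x ∷ mid ∷ʳ z) →
                   Σ (Star R x z) λ w → after w ≡ mid ∷ʳ z
  walk-of-linked x []        z (e ∷ [-]) = e ◅ ε , refl
  walk-of-linked x (m ∷ mid) z (e ∷ l) with walk-of-linked m mid z l
  ... | w , after-w = e ◅ w , cong (m ∷_) after-w

  two-vertices : ∀ {x z} (w : Star R x z) → x ≢ z → 2 ≤ length (vertices w)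
  two-vertices ε       x≢x = contradiction refl x≢x
  two-vertices (e ◅ w) _   = s≤s (s≤s z≤n)

  suffix-from : ∀ {x y z} (w : Star R y z) → x ∈ vertices w →
                Σ (Star R x z) λ q → Σ ℕ λ k → vertices q ≡ drop k (vertices w)
  suffix-from w       (here refl) = w , 0 , refl
  suffix-from (e ◅ w) (there x∈w) with suffix-from w x∈w
  ... | q , k , q≡ = q , suc k , q≡

  last-vertex : ∀ {P : A → Set} {x z} (w : Star R x z) → All P (vertices w) → P z
  last-vertex ε       (Pz ∷ []) = Pz
  last-vertex (_ ◅ w) (_ ∷ Pw)  = last-vertex w Pw

  proper-step : ∀ {x y} → ReflClosure R x y → x ≢ y → R x y
  proper-step refl  x≢x = contradiction refl x≢x
  proper-step [ r ] _   = r

  close-path : ∀ {D : A → Set} {c x z} → R c x → (p : Star R x z) → R z c → x ≢ z →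
               Unique (vertices p) → All (_≢ c) (vertices p) → D c → All D (vertices p) →
               Cycle D R
  close-path {c = c} r p r′ x≢z p-unique p-avoids Dc p-in-D =
    c , vertices p , two-vertices p x≢z ,
    (All.map ≢-sym p-avoids ∷ p-unique) , (Dc ∷ p-in-D) , (r ∷ linked-snoc p r′)

module _ {A : Set} (_≟_ : DecidableEquality A) {R : A → A → Set} where
  open import Data.List.Membership.DecPropositional _≟_ using (_∈?_)

  erase : ∀ {Q : A → Set} {x z} (w : Star (ReflClosure R) x z) → All Q (vertices w) →
          Σ (Star R x z) λ p → Unique (vertices p) × All Q (vertices p)
  erase ε           Qw       = ε , ([] ∷ []) , Qw
  erase (refl ◅ w) (_ ∷ Qw) = erase w Qw
  erase {x = x} ([ r ] ◅ w) (Qx ∷ Qw) with erase w Qw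
  ... | p , p-unique , Qp with x ∈? vertices p
  ...   | yes x∈p = let q , k , q≡ = suffix-from p x∈p in
                    q , subst Unique (sym q≡) (Uniqueₚ.drop⁺ k p-unique) ,
                        subst (All _) (sym q≡) (Allₚ.drop⁺ k Qp)
  ...   | no x∉p  = r ◅ p , (Allₚ.¬Any⇒All¬ _ x∉p ∷ p-unique) , (Qx ∷ Qp)

module _ {A : Set} (E : A → A → Set) (Z : A → Set) where

  IsCycle : A → List A → Set
  IsCycle x xs = (2 ≤ length xs) × Unique (x ∷ xs) × All Z (x ∷ xs) × Linked E ((x ∷ xs) ∷ʳ x)

  linked-append : ∀ l {x y} → Linked E (l ∷ʳ x) → E x y → Linked E (l ∷ʳ x ∷ʳ y)
  linked-append []          _         e′ = e′ ∷ [-]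
  linked-append (a ∷ [])    (e ∷ [-]) e′ = e ∷ e′ ∷ [-]
  linked-append (a ∷ b ∷ l) (e ∷ es)  e′ = e ∷ linked-append (b ∷ l) es e′

  linked-unsnoc : ∀ l {x y} → Linked E (l ∷ʳ x ∷ʳ y) → Linked E (l ∷ʳ x) × E x y
  linked-unsnoc []          (e ∷ [-]) = [-] , e
  linked-unsnoc (a ∷ [])    (e ∷ es)  = (e ∷ [-]) , proj₂ (linked-unsnoc [] es)
  linked-unsnoc (a ∷ b ∷ l) (e ∷ es)  = Product.map₁ (e ∷_) (linked-unsnoc (b ∷ l) es)

  rotate-once : ∀ {x y ys} → IsCycle x (y ∷ ys) → IsCycle y (ys ∷ʳ x)
  rotate-once {x} {y} {ys} (long , (x∉ ∷ y-rest-unique) , (Zx ∷ Z-rest) , (e ∷ es)) =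
    subst (2 ≤_) (sym (Listₚ.length-++-comm ys (x ∷ []))) long ,
    Uniqueₚ.++⁺ y-rest-unique ([] ∷ []) (λ { (x∈ , here refl) → Allₚ.All¬⇒¬Any x∉ x∈ }) ,
    Allₚ.∷ʳ⁺ Z-rest Zx ,
    linked-append (y ∷ ys) es e

  rotate : ∀ L {x v} M → IsCycle x (L ++ v ∷ M) → IsCycle v (M ++ x ∷ L)
  rotate []      M c = rotate-once c
  rotate (l ∷ L) {x} {v} M c =
    subst (IsCycle v) (Listₚ.++-assoc M (x ∷ []) (l ∷ L))
      (rotate L (M ∷ʳ x) (subst (IsCycle l) (Listₚ.++-assoc L (v ∷ M) (x ∷ [])) (rotate-once c)))

  cycle-at : ∀ {S : A → Set} → CycleThrough S Z E → Σ A λ v → S v × Σ (List A) (IsCycle v)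
  cycle-at (x , xs , c-long , c-unique , c-in-Z , c-linked , through-S)
    with find through-S
  ... | v , v∈ , Sv with ∈-∃++ v∈
  ...   | []    , M , refl = v , Sv , M , c-long , c-unique , c-in-Z , c-linked
  ...   | l ∷ L , M , refl = v , Sv , M ++ l ∷ L , rotate L M (c-long , c-unique , c-in-Z , c-linked)

  record Loop (v : A) : Set where
    field
      {first last} : A
      out          : E v first
      inner        : Star E first last
      back         : E last v
      ends-differ  : first ≢ last
      avoids       : All (_≢ v) (vertices inner)
      inner-in-Z   : All Z (vertices inner)

  loop-of-cycle : ∀ {v ys} → IsCycle v ys → Loop v
  loop-of-cycle {v} {b ∷ zs} c with initLast zs
  loop-of-cycle {v} {b ∷ .[]} (s≤s () , _) | []
  loop-of-cycle {v} {b ∷ .(mid ∷ʳ a)} (_ , (v∉ ∷ b∉ ∷ _) , (_ ∷ Z-rest) , (out ∷ es)) | mid ∷ʳ′ a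
    with linked-unsnoc (b ∷ mid) es
  ... | inner-linked , back with walk-of-linked b mid a inner-linked
  ...   | inner , after≡ = record
    { out         = out
    ; inner       = inner
    ; back        = back
    ; ends-differ = proj₂ (Allₚ.∷ʳ⁻ b∉)
    ; avoids      = subst (All (_≢ v)) (cong (b ∷_) (sym after≡)) (All.map ≢-sym v∉)
    ; inner-in-Z  = subst (All Z) (cong (b ∷_) (sym after≡)) Z-rest
    }

module CycleContraction {A B : Set} (_≟_ : DecidableEquality B)
  (E : A → A → Set) (Z S : A → Set) (R : B → B → Set) (D : B → Set) (f : A → B)
  (edge-image : ∀ {u w} → Z u → Z w → E u w → ReflClosure R (f u) (f w))
  (in-block   : ∀ {u} → Z u → D (f u))
  (isolated   : ∀ {u v} → Z u → Z v → S v → u ≢ v → f u ≢ f v)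
  (separated  : ∀ {v a b} → Z v → S v → Z a → Z b → E v a → E b v → a ≢ b → f a ≢ f b)
  where

  module _ {v : A} (Zv : Z v) (Sv : S v) where

    -- Edges at v are never collapsed.
    edge-from : ∀ {u} → Z u → u ≢ v → E v u → R (f v) (f u)
    edge-from Zu u≢v e = proper-step (edge-image Zv Zu e) (≢-sym (isolated Zu Zv Sv u≢v))

    edge-to : ∀ {u} → Z u → u ≢ v → E u v → R (f u) (f v)
    edge-to Zu u≢v e = proper-step (edge-image Zu Zv e) (isolated Zu Zv Sv u≢v)

    OtherBlock : B → Set
    OtherBlock X = X ≢ f v × D X

    image-walk : ∀ {a b} (w : Star E a b) → All Z (vertices w) → All (_≢ v) (vertices w) →
                 Σ (Star (ReflClosure R) (f a) (f b)) λ w′ → All OtherBlock (vertices w′)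
    image-walk ε       (Za ∷ [])  (a≢v ∷ []) = ε , (isolated Za Zv Sv a≢v , in-block Za) ∷ []
    image-walk (e ◅ w) (Za ∷ Z-w) (a≢v ∷ w-avoids) with image-walk w Z-w w-avoids
    ... | w′ , w′-other =
      edge-image Za (All.head Z-w) e ◅ w′ , (isolated Za Zv Sv a≢v , in-block Za) ∷ w′-other

    module _ (loop : Loop E Z v) where
      open Loop loop

      Z-first : Z first
      Z-first = All.head inner-in-Z

      Z-last : Z last
      Z-last = last-vertex inner inner-in-Z

      contract-loop : Cycle D R
      contract-loop with image-walk inner inner-in-Z avoids
      ... | w′ , w′-other with erase _≟_ w′ w′-other
      ...   | p , p-unique , p-other =
        close-path (edge-from Z-first (All.head avoids) out) p
                   (edge-to Z-last (last-vertex inner avoids) back)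
                   (separated Zv Sv Z-first Z-last out back ends-differ)
                   p-unique (All.map proj₁ p-other) (in-block Zv) (All.map proj₂ p-other)

  contract : CycleThrough S Z E → Cycle D R
  contract c with cycle-at E Z c
  ... | v , Sv , ys , ys-cycle@(_ , _ , Zv ∷ _ , _) = contract-loop Zv Sv (loop-of-cycle E Z ys-cycle)

-- A collection 𝒬 of vertex sets partitions the vertices satisfying W.  Covering is
-- only required up to double negation, which suffices for proving negations.
record Partitions {n : ℕ} (𝒬 : Coll n) (W : Fin n → Set) : Set₁ where
  field
    block-⊆  : ∀ {B u} → 𝒬 B → u ∈ˢ B → W u
    disjoint : ∀ {B₁ B₂ u} → 𝒬 B₁ → 𝒬 B₂ → u ∈ˢ B₁ → u ∈ˢ B₂ → B₁ ≡ B₂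
    covers   : ∀ {u} → W u → ¬ ¬ Σ (Subset n) λ B → 𝒬 B × u ∈ˢ B

module _ {n : ℕ} where

  partitions-resp : ∀ {𝒬 : Coll n} {W W′ : Fin n → Set} →
                    (∀ {u} → W u → W′ u) → (∀ {u} → W′ u → W u) →
                    Partitions 𝒬 W → Partitions 𝒬 W′
  partitions-resp W⇒W′ W′⇒W 𝒬-part = record
    { block-⊆  = λ B u∈B → W⇒W′ (block-⊆ B u∈B)
    ; disjoint = disjoint
    ; covers   = covers ∘ W′⇒W
    }
    where open Partitions 𝒬-part

  partitions-∪ : ∀ {𝒜 ℬ : Coll n} {W₁ W₂ : Fin n → Set} → (∀ {u} → W₁ u → W₂ u → False) →
                 Partitions 𝒜 W₁ → Partitions ℬ W₂ → Partitions (𝒜 ∪ᶜ ℬ) (λ u → W₁ u ⊎ W₂ u)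
  partitions-∪ {𝒜} {ℬ} W₁∩W₂=∅ 𝒜-part ℬ-part = record
    { block-⊆  = λ { (inj₁ A) u∈A → inj₁ (𝒜.block-⊆ A u∈A) ; (inj₂ B) u∈B → inj₂ (ℬ.block-⊆ B u∈B) }
    ; disjoint = disjoint
    ; covers   = λ { (inj₁ w₁) → ¬¬-map (Product.map₂ (Product.map₁ inj₁)) (𝒜.covers w₁)
                   ; (inj₂ w₂) → ¬¬-map (Product.map₂ (Product.map₁ inj₂)) (ℬ.covers w₂) }
    }
    where
    module 𝒜 = Partitions 𝒜-part
    module ℬ = Partitions ℬ-part
    disjoint : ∀ {B₁ B₂ u} → (𝒜 ∪ᶜ ℬ) B₁ → (𝒜 ∪ᶜ ℬ) B₂ → u ∈ˢ B₁ → u ∈ˢ B₂ → B₁ ≡ B₂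
    disjoint (inj₁ A₁) (inj₁ A₂) u∈₁ u∈₂ = 𝒜.disjoint A₁ A₂ u∈₁ u∈₂
    disjoint (inj₂ B₁) (inj₂ B₂) u∈₁ u∈₂ = ℬ.disjoint B₁ B₂ u∈₁ u∈₂
    disjoint (inj₁ A)  (inj₂ B)  u∈A u∈B = ⊥-elim (W₁∩W₂=∅ (𝒜.block-⊆ A u∈A) (ℬ.block-⊆ B u∈B))
    disjoint (inj₂ B)  (inj₁ A)  u∈B u∈A = ⊥-elim (W₁∩W₂=∅ (𝒜.block-⊆ A u∈A) (ℬ.block-⊆ B u∈B))

  pairwise-disjoint-unique : ∀ {𝒫 : List (Subset n)} {P Q u} →
                             AllPairs (λ P Q → ∀ v → v ∈ˢ P → v ∉ˢ Q) 𝒫 →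
                             P ∈ 𝒫 → Q ∈ 𝒫 → u ∈ˢ P → u ∈ˢ Q → P ≡ Q
  pairwise-disjoint-unique (_ ∷ _)      (here refl) (here refl) _   _   = refl
  pairwise-disjoint-unique (P#𝒫 ∷ _)    (here refl) (there Q∈)  u∈P u∈Q =
    ⊥-elim (All.lookup P#𝒫 Q∈ _ u∈P u∈Q)
  pairwise-disjoint-unique (Q#𝒫 ∷ _)    (there P∈)  (here refl) u∈P u∈Q =
    ⊥-elim (All.lookup Q#𝒫 P∈ _ u∈Q u∈P)
  pairwise-disjoint-unique (_ ∷ 𝒫-disj) (there P∈)  (there Q∈)  u∈P u∈Q =
    pairwise-disjoint-unique 𝒫-disj P∈ Q∈ u∈P u∈Q

module _ {n : ℕ} (G : Graph n) where

  list-partitions : ∀ {𝒫 W} → IsPartition G 𝒫 W → Partitions (fromList 𝒫) (_∈ˢ W)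
  list-partitions (_ , 𝒫-disj , 𝒫-cover) = record
    { block-⊆  = λ {P} {u} P∈ u∈P → proj₂ (𝒫-cover u) P P∈ u∈P
    ; disjoint = pairwise-disjoint-unique 𝒫-disj
    ; covers   = λ {u} u∈W k → k (proj₁ (𝒫-cover u) u∈W)
    }

  reach-start : ∀ {W v u} → Reach G W v u → v ∈ˢ W
  reach-start (here v∈W)     = v∈W
  reach-start (step v∈W _ _) = v∈W

  reach-end : ∀ {W v u} → Reach G W v u → u ∈ˢ W
  reach-end (here u∈W)   = u∈W
  reach-end (step _ _ r) = reach-end r

  reach-trans : ∀ {W u v w} → Reach G W u v → Reach G W v w → Reach G W u w
  reach-trans (here _)       r′ = r′
  reach-trans (step u∈W e r) r′ = step u∈W e (reach-trans r r′)

  reach-sym : ∀ {W v u} → Reach G W v u → Reach G W u v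
  reach-sym (here v∈W) = here v∈W
  reach-sym {v = v} (step {w = w} v∈W e r) =
    reach-trans (reach-sym r) (step (reach-start r) (nbr-sym G v w e) (here v∈W))

  component-connected : ∀ {W C u w} → cc G W C → u ∈ˢ C → w ∈ˢ C → Reach G W u w
  component-connected (_ , _ , C-def) u∈C w∈C =
    reach-trans (reach-sym (proj₁ (C-def _) u∈C)) (proj₁ (C-def _) w∈C)

  component-closed : ∀ {W C u w} → cc G W C → u ∈ˢ C → Reach G W u w → w ∈ˢ C
  component-closed (_ , _ , C-def) u∈C u⇝w =
    proj₂ (C-def _) (reach-trans (proj₁ (C-def _) u∈C) u⇝w)

  components-disjoint : ∀ {W C₁ C₂ u} → cc G W C₁ → cc G W C₂ → u ∈ˢ C₁ → u ∈ˢ C₂ → C₁ ≡ C₂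
  components-disjoint C₁-comp C₂-comp u∈C₁ u∈C₂ =
    ⊆-antisym (component-closed C₂-comp u∈C₂ ∘ component-connected C₁-comp u∈C₁)
              (component-closed C₁-comp u∈C₁ ∘ component-connected C₂-comp u∈C₂)

  components-partition : ∀ W → Partitions (cc G W) (_∈ˢ W)
  components-partition W = record
    { block-⊆  = λ { (v , _ , C-def) u∈C → reach-end (proj₁ (C-def _) u∈C) }
    ; disjoint = components-disjoint
    ; covers   = λ {u} u∈W → ¬¬-map (λ { (C , C-def) → C , (u , u∈W , C-def) , proj₂ (C-def u) (here u∈W) })
                                     (¬¬-comprehension (Reach G W u))
    }

  down-partition : ∀ {S Z 𝒬} → Partitions 𝒬 (λ u → u ∈ˢ Z × u ∉ˢ S) → Partitions (Down G S Z 𝒬) (_∈ˢ Z)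
  down-partition {S} {Z} {𝒬} 𝒬-part = record
    { block-⊆  = λ { (inj₁ Q) u∈Q → proj₁ (𝒬.block-⊆ Q u∈Q)
                   ; (inj₂ (s , s∈Z , _ , refl)) u∈⁅s⁆ → subst (_∈ˢ Z) (sym (x∈⁅y⁆⇒x≡y s u∈⁅s⁆)) s∈Z }
    ; disjoint = disjoint
    ; covers   = covers
    }
    where
    module 𝒬 = Partitions 𝒬-part

    disjoint : ∀ {B₁ B₂ u} → Down G S Z 𝒬 B₁ → Down G S Z 𝒬 B₂ → u ∈ˢ B₁ → u ∈ˢ B₂ → B₁ ≡ B₂
    disjoint (inj₁ Q₁) (inj₁ Q₂) u∈₁ u∈₂ = 𝒬.disjoint Q₁ Q₂ u∈₁ u∈₂
    disjoint (inj₂ (s , _ , _ , refl)) (inj₂ (t , _ , _ , refl)) u∈⁅s⁆ u∈⁅t⁆ =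
      cong ⁅_⁆ (trans (sym (x∈⁅y⁆⇒x≡y s u∈⁅s⁆)) (x∈⁅y⁆⇒x≡y t u∈⁅t⁆))
    disjoint (inj₁ Q) (inj₂ (s , _ , s∈S , refl)) u∈Q u∈⁅s⁆ =
      ⊥-elim (proj₂ (𝒬.block-⊆ Q u∈Q) (subst (_∈ˢ S) (sym (x∈⁅y⁆⇒x≡y s u∈⁅s⁆)) s∈S))
    disjoint (inj₂ (s , _ , s∈S , refl)) (inj₁ Q) u∈⁅s⁆ u∈Q =
      ⊥-elim (proj₂ (𝒬.block-⊆ Q u∈Q) (subst (_∈ˢ S) (sym (x∈⁅y⁆⇒x≡y s u∈⁅s⁆)) s∈S))

    covers : ∀ {u} → u ∈ˢ Z → ¬ ¬ Σ (Subset n) λ B → Down G S Z 𝒬 B × u ∈ˢ B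
    covers {u} u∈Z with u ∈ˢ? S
    ... | yes u∈S = λ k → k (⁅ u ⁆ , inj₂ (u , u∈Z , u∈S , refl) , x∈⁅x⁆ u)
    ... | no  u∉S = ¬¬-map (Product.map₂ (Product.map₁ inj₁)) (𝒬.covers (u∈Z , u∉S))

  module _ {S Z : Subset n} {𝒬 : Coll n} (𝒬-part : Partitions 𝒬 (λ u → u ∈ˢ Z × u ∉ˢ S))
    (at-most-one : ∀ {v B} → v ∈ˢ Z → v ∈ˢ S → Down G S Z 𝒬 B → ∣ nbr G v ∩ B ∣ ≤ 1)
    where

    private
      𝒟 : Coll n
      𝒟 = Down G S Z 𝒬

      open Partitions (down-partition 𝒬-part)

    module _ (f : Fin n → Subset n) (f-blocks : ∀ u → u ∈ˢ Z → 𝒟 (f u) × u ∈ˢ f u) where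

      f-block : ∀ {u} → u ∈ˢ Z → 𝒟 (f u)
      f-block {u} u∈Z = proj₁ (f-blocks u u∈Z)

      f-member : ∀ {u} → u ∈ˢ Z → u ∈ˢ f u
      f-member {u} u∈Z = proj₂ (f-blocks u u∈Z)

      f-singleton : ∀ {v} → v ∈ˢ Z → v ∈ˢ S → f v ≡ ⁅ v ⁆
      f-singleton {v} v∈Z v∈S =
        disjoint (f-block v∈Z) (inj₂ (v , v∈Z , v∈S , refl)) (f-member v∈Z) (x∈⁅x⁆ v)

      edge-image : ∀ {u w} → u ∈ˢ Z → w ∈ˢ Z → w ∈ˢ nbr G u → ReflClosure (Contr G 𝒟) (f u) (f w)
      edge-image {u} {w} u∈Z w∈Z e with w ∈ˢ? f u
      ... | yes w∈fu = Refl.reflexive (disjoint (f-block u∈Z) (f-block w∈Z) w∈fu (f-member w∈Z))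
      ... | no  w∉fu = [ f-block u∈Z , f-block w∈Z , inj₁ (u , w , f-member u∈Z , f-member w∈Z , w∉fu , e) ]

      isolated : ∀ {u v} → u ∈ˢ Z → v ∈ˢ Z → v ∈ˢ S → u ≢ v → f u ≢ f v
      isolated {u} {v} u∈Z v∈Z v∈S u≢v fu≡fv =
        u≢v (x∈⁅y⁆⇒x≡y v (subst (u ∈ˢ_) (trans fu≡fv (f-singleton v∈Z v∈S)) (f-member u∈Z)))

      separated : ∀ {v a b} → v ∈ˢ Z → v ∈ˢ S → a ∈ˢ Z → b ∈ˢ Z →
                  a ∈ˢ nbr G v → v ∈ˢ nbr G b → a ≢ b → f a ≢ f b
      separated {v} {a} {b} v∈Z v∈S a∈Z b∈Z a~v v~b a≢b fa≡fb =
        a≢b (∣p∣≤1⇒unique (at-most-one v∈Z v∈S (f-block a∈Z))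
               (x∈p∩q⁺ (a~v , f-member a∈Z))
               (x∈p∩q⁺ (nbr-sym G b v v~b , subst (b ∈ˢ_) (sym fa≡fb) (f-member b∈Z))))

      open CycleContraction (≡-dec Boolₚ._≟_) (λ u w → w ∈ˢ nbr G u) (_∈ˢ Z) (_∈ˢ S)
                            (Contr G 𝒟) 𝒟 f edge-image f-block isolated separated
        using (contract) public

    -- Every vertex of Z lies in some block; classically these choices form a map.
    block-of : ∀ u → ¬ ¬ Σ (Subset n) λ B → u ∈ˢ Z → 𝒟 B × u ∈ˢ B
    block-of u with u ∈ˢ? Z
    ... | yes u∈Z = ¬¬-map (λ { (B , B-block) → B , λ _ → B-block }) (covers u∈Z)
    ... | no  u∉Z = λ k → k (⁅ u ⁆ , λ u∈Z → contradiction u∈Z u∉Z)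

    down-forest⇒S-forest : ForestC G 𝒟 → SForest G S Z
    down-forest⇒S-forest forest cycle =
      ¬¬-∀ block-of λ blocks → forest (contract (proj₁ ∘ blocks) (proj₂ ∘ blocks) cycle)

2⊓m≤1⇒m≤1 : ∀ m → 2 ⊓ m ≤ 1 → m ≤ 1
2⊓m≤1⇒m≤1 zero          _        = z≤n
2⊓m≤1⇒m≤1 (suc zero)    _        = s≤s z≤n
2⊓m≤1⇒m≤1 (suc (suc m)) (s≤s ())

module _ {n : ℕ} (G : Graph n) where

  equiv₁-adjacent : ∀ {A W₁ W₂ u x} → Equiv G 1 A W₁ W₂ → u ∉ˢ A → x ∈ˢ W₂ → x ∈ˢ nbr G u →
                    ∃[ y ] (y ∈ˢ W₁ × y ∈ˢ nbr G u)
  equiv₁-adjacent {A} {W₁} {W₂} {u} W₁≡W₂ u∉A x∈W₂ x~u =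
    Product.map₂ (x∈p∩q⁻ W₁ (nbr G u)) (1≤∣p∣⇒nonempty 1≤∣W₁∩N∣)
    where
    1≤∣W₁∩N∣ : 1 ≤ ∣ W₁ ∩ nbr G u ∣
    1≤∣W₁∩N∣ = begin
      1                      ≡⟨ sym (m≤n⇒m⊓n≡m (∈⇒1≤∣p∣ (x∈p∩q⁺ (x∈W₂ , x~u)))) ⟩
      1 ⊓ ∣ W₂ ∩ nbr G u ∣   ≡⟨ sym (W₁≡W₂ u u∉A) ⟩
      1 ⊓ ∣ W₁ ∩ nbr G u ∣   ≤⟨ m⊓n≤n 1 _ ⟩
      ∣ W₁ ∩ nbr G u ∣       ∎
      where open ≤-Reasoning

  equiv₂-at-most-one : ∀ {A W₁ W₂ u} → Equiv G 2 A W₁ W₂ → u ∉ˢ A →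
                       ∣ nbr G u ∩ W₁ ∣ ≤ 1 → ∣ nbr G u ∩ W₂ ∣ ≤ 1
  equiv₂-at-most-one {A} {W₁} {W₂} {u} W₁≡W₂ u∉A ∣N∩W₁∣≤1 =
    subst (_≤ 1) (cong ∣_∣ (∩-comm W₂ (nbr G u))) (2⊓m≤1⇒m≤1 _ 2⊓∣W₂∩N∣≤1)
    where
    2⊓∣W₂∩N∣≤1 : 2 ⊓ ∣ W₂ ∩ nbr G u ∣ ≤ 1
    2⊓∣W₂∩N∣≤1 = begin
      2 ⊓ ∣ W₂ ∩ nbr G u ∣   ≡⟨ sym (W₁≡W₂ u u∉A) ⟩
      2 ⊓ ∣ W₁ ∩ nbr G u ∣   ≤⟨ m⊓n≤n 2 _ ⟩
      ∣ W₁ ∩ nbr G u ∣       ≡⟨ cong ∣_∣ (∩-comm W₁ (nbr G u)) ⟩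
      ∣ nbr G u ∩ W₁ ∣       ≤⟨ ∣N∩W₁∣≤1 ⟩
      1                      ∎
      where open ≤-Reasoning

  rep-singleton : ∀ {rank A v R a} → v ∈ˢ A → IsRep G rank 1 A ⁅ v ⁆ R → a ∉ˢ A → a ∈ˢ nbr G v →
                  ∃[ r ] (R ≡ ⁅ r ⁆ × (∀ {b} → b ∉ˢ A → b ∈ˢ nbr G v → b ∈ˢ nbr G r))
  rep-singleton {A = A} {v} {R} {a} v∈A (_ , R≡⁅v⁆ , R-minimum , _) a∉A a~v
    with equiv₁-adjacent R≡⁅v⁆ a∉A (x∈⁅x⁆ v) (nbr-sym G v a a~v)
  ... | r , r∈R , _ = r , ∣p∣≤1⇒p≡⁅x⁆ ∣R∣≤1 r∈R , adjacent
    where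
    ∣R∣≤1 : ∣ R ∣ ≤ 1
    ∣R∣≤1 = subst (∣ R ∣ ≤_) (∣⁅x⁆∣≡1 v) (R-minimum ⁅ v ⁆ (⁅x⁆⊆p v∈A) (λ _ _ → refl))

    adjacent : ∀ {b} → b ∉ˢ A → b ∈ˢ nbr G v → b ∈ˢ nbr G r
    adjacent {b} b∉A b~v with equiv₁-adjacent R≡⁅v⁆ b∉A (x∈⁅x⁆ v) (nbr-sym G v b b~v)
    ... | r′ , r′∈R , r′~b = subst (λ y → b ∈ˢ nbr G y) (∣p∣≤1⇒unique ∣R∣≤1 r′∈R r∈R) (nbr-sym G b r′ r′~b)

-- A partial solution X ⊆ V_x and a complement solution (Y, 𝒫) for the same index i,
-- given by the parts of their definitions that the argument uses: X ⊆ V_x with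
-- conditions (d), (e), (f) of partial solutions (for (f), W = X ∖ ⋃VC_X), and Y ⊆ ∁V_x
-- with 𝒫 a partition of Y ∖ S and conditions (d), (e), (f) of complement solutions.
module SolutionPair {n : ℕ} (G : Graph n) (S : Subset n) (rank : Fin n → ℕ) (Vx : Subset n)
  (i : Index n) (X Y : Subset n) (𝒫 : List (Subset n))
  (Xv̄c⊆Vx : Xv̄c i ⊆ Vx)
  (X⊆Vx : X ⊆ Vx)
  (X-d : ∀ C v → cc G (X ─ S) C → ⁅ v ⁆ ∈ YvcS i → ∣ nbr G v ∩ C ∣ ≤ 1)
  (X-e : ∀ v U → v ∈ˢ X → v ∈ˢ S → (U ∈ YvcS̄ i ⊎ cc G (X ─ S) U) → ∣ nbr G v ∩ U ∣ ≤ 1)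
  (W : Subset n)
  (W-def : ∀ u → (u ∈ˢ W → u ∈ˢ X × ¬ InVC G S rank Vx X i u)
                 × (u ∈ˢ X → ¬ InVC G S rank Vx X i u → u ∈ˢ W))
  (Xv̄c≡W : Equiv G 1 Vx (Xv̄c i) W)
  (Y⊆∁Vx : Y ⊆ ∁ Vx)
  (𝒫-partition : IsPartition G 𝒫 (Y ─ S))
  (Y-d : ∀ P v → P ∈ 𝒫 → ⁅ v ⁆ ∈ XvcS i → ∣ nbr G v ∩ P ∣ ≤ 1)
  (Y-e : ∀ y R → y ∈ˢ Y → y ∈ˢ S → (R ∈ XvcS̄ i ⊎ R ∈ 𝒫) → ∣ nbr G y ∩ R ∣ ≤ 1)
  (Y-f : ∀ w u → w ∈ˢ Xv̄c i → u ∈ˢ nbr G w → u ∉ˢ Xv̄c i → ¬ InYv̄c G S rank Vx Y 𝒫 i u)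
  where

  𝒬 : Coll n
  𝒬 = cc G (X ─ S) ∪ᶜ fromList 𝒫

  X-outside : ∀ {u} → u ∈ˢ X → u ∉ˢ ∁ Vx
  X-outside u∈X = x∈p⇒x∉∁p (X⊆Vx u∈X)

  Y-outside : ∀ {u} → u ∈ˢ Y → u ∉ˢ Vx
  Y-outside u∈Y = x∈∁p⇒x∉p (Y⊆∁Vx u∈Y)

  in-component : ∀ {C u} → cc G (X ─ S) C → u ∈ˢ C → u ∈ˢ X × u ∉ˢ S
  in-component C-comp u∈C with Partitions.block-⊆ (components-partition G (X ─ S)) C-comp u∈C
  ... | u∈X─S = p─q⊆p X S u∈X─S , x∈p─q⇒x∉q X S u∈X─S

  in-part : ∀ {P u} → P ∈ 𝒫 → u ∈ˢ P → u ∈ˢ Y × u ∉ˢ S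
  in-part P∈𝒫 u∈P with Partitions.block-⊆ (list-partitions G 𝒫-partition) P∈𝒫 u∈P
  ... | u∈Y─S = p─q⊆p Y S u∈Y─S , x∈p─q⇒x∉q Y S u∈Y─S

  -- The components of G[X ∖ S] and the parts of 𝒫 partition (X ∪ Y) ∖ S, since X and
  -- Y lie on different sides of V_x.
  blocks-partition : Partitions 𝒬 (λ u → u ∈ˢ X ∪ Y × u ∉ˢ S)
  blocks-partition =
    partitions-resp to from
      (partitions-∪ (λ u∈X─S u∈Y─S → Y-outside (p─q⊆p Y S u∈Y─S) (X⊆Vx (p─q⊆p X S u∈X─S)))
                    (components-partition G (X ─ S)) (list-partitions G 𝒫-partition))
    where
    to : ∀ {u} → u ∈ˢ X ─ S ⊎ u ∈ˢ Y ─ S → u ∈ˢ X ∪ Y × u ∉ˢ S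
    to (inj₁ u∈X─S) = x∈p∪q⁺ (inj₁ (p─q⊆p X S u∈X─S)) , x∈p─q⇒x∉q X S u∈X─S
    to (inj₂ u∈Y─S) = x∈p∪q⁺ (inj₂ (p─q⊆p Y S u∈Y─S)) , x∈p─q⇒x∉q Y S u∈Y─S

    from : ∀ {u} → u ∈ˢ X ∪ Y × u ∉ˢ S → u ∈ˢ X ─ S ⊎ u ∈ˢ Y ─ S
    from (u∈X∪Y , u∉S) = Sum.map (λ u∈X → x∈p∧x∉q⇒x∈p─q u∈X u∉S) (λ u∈Y → x∈p∧x∉q⇒x∈p─q u∈Y u∉S)
                                 (x∈p∪q⁻ X Y u∈X∪Y)

  S-vertex-not-in-VC : ∀ {v} → v ∈ˢ S → ¬ RepIn G rank 1 Vx ⁅ v ⁆ (XvcS i) → ¬ InVC G S rank Vx X i v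
  S-vertex-not-in-VC _   ¬rep (inj₁ (_ , _ , rep))        = ¬rep rep
  S-vertex-not-in-VC v∈S _    (inj₂ (_ , C-comp , v∈C , _)) = proj₂ (in-component C-comp v∈C) v∈S

  component-not-in-VC : ∀ {C a} → cc G (X ─ S) C → a ∈ˢ C → ¬ RepIn G rank 2 Vx C (XvcS̄ i) →
                        ¬ InVC G S rank Vx X i a
  component-not-in-VC C-comp a∈C _ (inj₁ (_ , a∈S , _)) = proj₂ (in-component C-comp a∈C) a∈S
  component-not-in-VC C-comp a∈C ¬rep (inj₂ (C′ , C′-comp , a∈C′ , rep)) =
    ¬rep (subst (λ D → RepIn G rank 2 Vx D (XvcS̄ i))
                (components-disjoint G C′-comp C-comp a∈C′ a∈C) rep)

  -- A vertex v ∈ X ∩ S has at most one neighbour in a part P ∈ 𝒫, by three cases: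
  --  (i)   rep(P) ∈ Y_vc^S̄: condition (e) of X bounds the neighbours of v in rep(P), and
  --        2-equivalence carries the bound over to P;
  --  (ii)  rep({v}) ∈ X_vc^S: it is a singleton {r} adjacent to all outside neighbours of
  --        v, and condition (d) of Y bounds the neighbours of r in P;
  --  (iii) otherwise v ∈ X ∖ ⋃VC_X, so any neighbour a ∈ P of v is adjacent to X_v̄c, and
  --        lies in ⋃Y_v̄c, which condition (f) of Y forbids.
  X-vertex-meets-part : ∀ {v P} → v ∈ˢ X → v ∈ˢ S → P ∈ 𝒫 → ∣ nbr G v ∩ P ∣ ≤ 1
  X-vertex-meets-part {v} {P} v∈X v∈S P∈𝒫 =
    by-cases (_ ≤ℕ? 1) (RepIn G rank 2 (∁ Vx) P (YvcS̄ i)) via-rep-P λ ¬rep-P →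
    by-cases (_ ≤ℕ? 1) (RepIn G rank 1 Vx ⁅ v ⁆ (XvcS i)) via-rep-v λ ¬rep-v →
    unique⇒∣p∣≤1 λ a∈ _ → ⊥-elim (no-neighbour ¬rep-P ¬rep-v (x∈p∩q⁻ (nbr G v) P a∈))
    where
    a∉Vx : ∀ {a} → a ∈ˢ P → a ∉ˢ Vx
    a∉Vx a∈P = Y-outside (proj₁ (in-part P∈𝒫 a∈P))

    via-rep-P : RepIn G rank 2 (∁ Vx) P (YvcS̄ i) → ∣ nbr G v ∩ P ∣ ≤ 1
    via-rep-P (U , (_ , U≡P , _) , U∈) =
      equiv₂-at-most-one G U≡P (X-outside v∈X) (X-e v U v∈X v∈S (inj₁ U∈))

    via-rep-v : RepIn G rank 1 Vx ⁅ v ⁆ (XvcS i) → ∣ nbr G v ∩ P ∣ ≤ 1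
    via-rep-v (R , R-rep , R∈) = unique⇒∣p∣≤1 λ a∈ b∈ →
      neighbours-agree (x∈p∩q⁻ _ _ a∈) (x∈p∩q⁻ _ _ b∈)
      where
      neighbours-agree : ∀ {a b} → a ∈ˢ nbr G v × a ∈ˢ P → b ∈ˢ nbr G v × b ∈ˢ P → a ≡ b
      neighbours-agree (a~v , a∈P) (b~v , b∈P) with rep-singleton G (X⊆Vx v∈X) R-rep (a∉Vx a∈P) a~v
      ... | r , R≡⁅r⁆ , r-adjacent =
        ∣p∣≤1⇒unique (Y-d P r P∈𝒫 (subst (_∈ XvcS i) R≡⁅r⁆ R∈))
          (x∈p∩q⁺ (r-adjacent (a∉Vx a∈P) a~v , a∈P)) (x∈p∩q⁺ (r-adjacent (a∉Vx b∈P) b~v , b∈P))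

    v∈W : ¬ RepIn G rank 1 Vx ⁅ v ⁆ (XvcS i) → v ∈ˢ W
    v∈W ¬rep-v = proj₂ (W-def v) v∈X (S-vertex-not-in-VC v∈S ¬rep-v)

    no-neighbour : ¬ RepIn G rank 2 (∁ Vx) P (YvcS̄ i) → ¬ RepIn G rank 1 Vx ⁅ v ⁆ (XvcS i) →
                   ∀ {a} → a ∈ˢ nbr G v × a ∈ˢ P → False
    no-neighbour ¬rep-P ¬rep-v {a} (a~v , a∈P)
      with equiv₁-adjacent G Xv̄c≡W (a∉Vx a∈P) (v∈W ¬rep-v) (nbr-sym G v a a~v)
    ... | w , w∈Xv̄c , w~a =
      Y-f w a w∈Xv̄c (nbr-sym G a w w~a) (a∉Vx a∈P ∘ Xv̄c⊆Vx) (inj₂ (P , P∈𝒫 , a∈P , ¬rep-P))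

  -- Symmetrically, a vertex v ∈ Y ∩ S has at most one neighbour in a component C of
  -- G[X ∖ S]: (i) via rep(C) ∈ X_vc^S̄ and condition (e) of Y; (ii) via rep({v}) ∈
  -- Y_vc^S and condition (d) of X; (iii) otherwise a neighbour a ∈ C of v lies in
  -- X ∖ ⋃VC_X, so v is adjacent to X_v̄c while lying in ⋃Y_v̄c, contradicting (f) of Y.
  Y-vertex-meets-component : ∀ {v C} → v ∈ˢ Y → v ∈ˢ S → cc G (X ─ S) C → ∣ nbr G v ∩ C ∣ ≤ 1
  Y-vertex-meets-component {v} {C} v∈Y v∈S C-comp =
    by-cases (_ ≤ℕ? 1) (RepIn G rank 2 Vx C (XvcS̄ i)) via-rep-C λ ¬rep-C →
    by-cases (_ ≤ℕ? 1) (RepIn G rank 1 (∁ Vx) ⁅ v ⁆ (YvcS i)) via-rep-v λ ¬rep-v →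
    unique⇒∣p∣≤1 λ a∈ _ → ⊥-elim (no-neighbour ¬rep-C ¬rep-v (x∈p∩q⁻ (nbr G v) C a∈))
    where
    a∉∁Vx : ∀ {a} → a ∈ˢ C → a ∉ˢ ∁ Vx
    a∉∁Vx a∈C = X-outside (proj₁ (in-component C-comp a∈C))

    via-rep-C : RepIn G rank 2 Vx C (XvcS̄ i) → ∣ nbr G v ∩ C ∣ ≤ 1
    via-rep-C (R , (_ , R≡C , _) , R∈) =
      equiv₂-at-most-one G R≡C (Y-outside v∈Y) (Y-e v R v∈Y v∈S (inj₁ R∈))

    via-rep-v : RepIn G rank 1 (∁ Vx) ⁅ v ⁆ (YvcS i) → ∣ nbr G v ∩ C ∣ ≤ 1
    via-rep-v (U , U-rep , U∈) = unique⇒∣p∣≤1 λ a∈ b∈ →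
      neighbours-agree (x∈p∩q⁻ _ _ a∈) (x∈p∩q⁻ _ _ b∈)
      where
      neighbours-agree : ∀ {a b} → a ∈ˢ nbr G v × a ∈ˢ C → b ∈ˢ nbr G v × b ∈ˢ C → a ≡ b
      neighbours-agree (a~v , a∈C) (b~v , b∈C) with rep-singleton G (Y⊆∁Vx v∈Y) U-rep (a∉∁Vx a∈C) a~v
      ... | r , U≡⁅r⁆ , r-adjacent =
        ∣p∣≤1⇒unique (X-d C r C-comp (subst (_∈ YvcS i) U≡⁅r⁆ U∈))
          (x∈p∩q⁺ (r-adjacent (a∉∁Vx a∈C) a~v , a∈C)) (x∈p∩q⁺ (r-adjacent (a∉∁Vx b∈C) b~v , b∈C))

    a∈W : ¬ RepIn G rank 2 Vx C (XvcS̄ i) → ∀ {a} → a ∈ˢ C → a ∈ˢ W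
    a∈W ¬rep-C {a} a∈C =
      proj₂ (W-def a) (proj₁ (in-component C-comp a∈C)) (component-not-in-VC C-comp a∈C ¬rep-C)

    no-neighbour : ¬ RepIn G rank 2 Vx C (XvcS̄ i) → ¬ RepIn G rank 1 (∁ Vx) ⁅ v ⁆ (YvcS i) →
                   ∀ {a} → a ∈ˢ nbr G v × a ∈ˢ C → False
    no-neighbour ¬rep-C ¬rep-v {a} (a~v , a∈C)
      with equiv₁-adjacent G Xv̄c≡W (Y-outside v∈Y) (a∈W ¬rep-C a∈C) a~v
    ... | w , w∈Xv̄c , w~v =
      Y-f w v w∈Xv̄c (nbr-sym G v w w~v) (Y-outside v∈Y ∘ Xv̄c⊆Vx) (inj₁ (v∈Y , v∈S , ¬rep-v))

  at-most-one-neighbour : ∀ {v B} → v ∈ˢ X ∪ Y → v ∈ˢ S → Down G S (X ∪ Y) 𝒬 B → ∣ nbr G v ∩ B ∣ ≤ 1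
  at-most-one-neighbour {v} v∈Z v∈S (inj₂ (s , _ , _ , refl)) =
    subst (∣ nbr G v ∩ ⁅ s ⁆ ∣ ≤_) (∣⁅x⁆∣≡1 s) (∣p∩q∣≤∣q∣ (nbr G v) ⁅ s ⁆)
  at-most-one-neighbour v∈Z v∈S (inj₁ B) with x∈p∪q⁻ X Y v∈Z | B
  ... | inj₁ v∈X | inj₁ C-comp = X-e _ _ v∈X v∈S (inj₂ C-comp)
  ... | inj₁ v∈X | inj₂ P∈𝒫   = X-vertex-meets-part v∈X v∈S P∈𝒫
  ... | inj₂ v∈Y | inj₁ C-comp = Y-vertex-meets-component v∈Y v∈S C-comp
  ... | inj₂ v∈Y | inj₂ P∈𝒫   = Y-e _ _ v∈Y v∈S (inj₂ P∈𝒫)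

  S-forest : ForestC G (Down G S (X ∪ Y) 𝒬) → SForest G S (X ∪ Y)
  S-forest = down-forest⇒S-forest G blocks-partition at-most-one-neighbour

-- The theorem: only X_v̄c ⊆ V_x from i ∈ 𝕀_x and the conditions of the two solutions
-- listed in SolutionPair are needed.
lemma3p7 : {n : ℕ} (G : Graph n) (S : Subset n)
    (rank : Fin n → ℕ) → Injective _≡_ _≡_ rank →
    (T : Layout n) → IsLayout T → (x : Layout n) → NodeOf x T →
    (i : Index n) → InI G S rank (V x) i →
    (X : Subset n) → PartialSolution G S rank (V x) X i →
    (Y : Subset n) (𝒫Y : List (Subset n)) → ComplementSolution G S rank (V x) Y 𝒫Y i →
    ForestC G (Down G S (X ∪ Y) (cc G (X ─ S) ∪ᶜ fromList 𝒫Y)) →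
    SForest G S (X ∪ Y)
lemma3p7 G S rank _ _ _ x _ i (_ , _ , _ , _ , (_ , _ , Xv̄c⊆Vx , _) , _)
         X (X⊆Vx , _ , _ , _ , X-d , X-e , W , W-def , Xv̄c≡W)
         Y 𝒫 (Y⊆∁Vx , 𝒫-partition , _ , _ , _ , Y-d , Y-e , Y-f) =
  SolutionPair.S-forest G S rank (V x) i X Y 𝒫 Xv̄c⊆Vx
    X⊆Vx X-d X-e W W-def Xv̄c≡W Y⊆∁Vx 𝒫-partition Y-d Y-e Y-f
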